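{- For $m\geq0$ let $[2m-1]!!_q=[1]_q[3]_q\cdots[2m-1]_q$ (equal to $1$ for $m=0$). Then for every $n\geq0$ the matrix $([2i+2j-1]!!_q)_{0\leq i,j\leq n}$ has special Smith normal form $\mathrm{diag}\big(1,q^{\binom22}[2]!_q,q^{\binom42}[4]!_q,\ldots,q^{\binom{2n}2}[2n]!_q\big)$ over $\mathbb{Z}[q]$.
   Context: $[k]_q=1+q+\cdots+q^{k-1}$, $[k]!_q=[1]_q\cdots[k]_q$. For an $m\times n$ matrix $A$ over a commutative ring $R$, a matrix $D$ is a special Smith normal form (SSNF) of $A$ over $R$ if there exist $P\in \mathrm{SL}(m,R)$, $Q\in\mathrm{SL}(n,R)$ with $PAQ=D$, $D$ is diagonal, and $d_{ii}$ is a multiple in $R$ of $d_{jj}$ whenever $i\geq j$. -}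

module Defs where

open import Data.Nat as ℕ using (ℕ; zero; suc; _≤_)
open import Data.Nat.Combinatorics using (_C_)
open import Data.Integer as ℤ using (ℤ; 0ℤ; 1ℤ)
open import Data.Fin using (Fin; zero; suc; toℕ; punchIn)
open import Data.List using (List; []; _∷_; map)
open import Data.Product using (Σ; ∃; _×_)
open import Relation.Binary.PropositionalEquality using (_≡_; _≢_)
open import Relation.Nullary using (yes; no)

-- The polynomial ring ℤ[q]: coefficient lists (constant term first),
-- with equality "all coefficients agree" (trailing zeros irrelevant).

Poly : Set
Poly = List ℤ

coeff : Poly → ℕ → ℤ
coeff []      _       = 0ℤ
coeff (a ∷ p) zero    = a
coeff (a ∷ p) (suc k) = coeff p k

infix 4 _≈P_
_≈P_ : Poly → Poly → Set
p ≈P r = ∀ k → coeff p k ≡ coeff r k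

0P : Poly
0P = []

1P : Poly
1P = 1ℤ ∷ []

qP : Poly
qP = 0ℤ ∷ 1ℤ ∷ []

infixl 6 _+P_
_+P_ : Poly → Poly → Poly
[]      +P r       = r
(a ∷ p) +P []      = a ∷ p
(a ∷ p) +P (b ∷ r) = (a ℤ.+ b) ∷ (p +P r)

-P_ : Poly → Poly
-P p = map ℤ.-_ p

infixl 7 _*P_
_*P_ : Poly → Poly → Poly
[]      *P r = []
(a ∷ p) *P r = map (a ℤ.*_) r +P (0ℤ ∷ (p *P r))

_^P_ : Poly → ℕ → Poly
p ^P zero  = 1P
p ^P suc n = p *P (p ^P n)

_∣P_ : Poly → Poly → Set
p ∣P r = Σ Poly (λ c → r ≈P c *P p)

qInt : ℕ → Poly
qInt zero    = 0P
qInt (suc k) = (qP ^P k) +P qInt k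

qFact : ℕ → Poly
qFact zero    = 1P
qFact (suc k) = qInt (suc k) *P qFact k

qDFact : ℕ → Poly
qDFact zero    = 1P
qDFact (suc m) = qInt (suc (2 ℕ.* m)) *P qDFact m

Mat : ℕ → ℕ → Set
Mat m n = Fin m → Fin n → Poly

sumF : (n : ℕ) → (Fin n → Poly) → Poly
sumF zero    f = 0P
sumF (suc n) f = f zero +P sumF n (λ i → f (suc i))

_⊗_ : ∀ {m n p} → Mat m n → Mat n p → Mat m p
_⊗_ {n = n} A B i k = sumF n (λ j → A i j *P B j k)

_≈M_ : ∀ {m n} → Mat m n → Mat m n → Set
A ≈M B = ∀ i j → A i j ≈P B i j

sgn : ℕ → Poly
sgn zero    = 1P
sgn (suc k) = -P sgn k

det : (n : ℕ) → Mat n n → Poly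
det zero    A = 1P
det (suc n) A =
  sumF (suc n) (λ j → sgn (toℕ j) *P (A zero j *P det n (λ r c → A (suc r) (punchIn j c))))

IsSL : (n : ℕ) → Mat n n → Set
IsSL n P = det n P ≈P 1P

IsDiagonal : ∀ {m n} → Mat m n → Set
IsDiagonal D = ∀ i j → toℕ i ≢ toℕ j → D i j ≈P 0P

DiagDivChain : ∀ {m n} → Mat m n → Set
DiagDivChain {m} {n} D =
  ∀ (i j : Fin m) (i' j' : Fin n) → toℕ i ≡ toℕ i' → toℕ j ≡ toℕ j' →
  toℕ j ≤ toℕ i → D j j' ∣P D i i'

IsSSNF : ∀ {m n} → Mat m n → Mat m n → Set
IsSSNF {m} {n} A D =
  Σ (Mat m m) λ P → Σ (Mat n n) λ Q →
    IsSL m P × IsSL n Q × ((P ⊗ A) ⊗ Q) ≈M D × IsDiagonal D × DiagDivChain D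

dfMatrix : (n : ℕ) → Mat (suc n) (suc n)
dfMatrix n i j = qDFact (toℕ i ℕ.+ toℕ j)

dfSNF : (n : ℕ) → Mat (suc n) (suc n)
dfSNF n i j with toℕ i ℕ.≟ toℕ j
... | yes _ = (qP ^P ((2 ℕ.* toℕ i) C 2)) *P qFact (2 ℕ.* toℕ i)
... | no _ = 0P

module Submission where

-- The matrix ([2i+2j-1]!!_q)_{i,j ≤ n} is the Hankel matrix (μ_{i+j}) of the moments
-- μ_m of the Stieltjes continued fraction with coefficients c_s = q^s [s+1]_q.
--
-- For an arbitrary Stieltjes fraction the moments are read off its Stieltjes table
-- (weighted path counts).  Contracting the fraction to a Jacobi fraction (b_i, λ_i)
-- gives monic orthogonal polynomials p_i; their coefficient matrix P is lower
-- unitriangular and P H Pᵀ = diag(D₀, …, D_n) with D_i = λ₀ ⋯ λ_{i-1}, because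
-- ⟨x^l p_i⟩ = D_i L_{l,i} with L the (unitriangular) contracted table.
-- So P and Q = Pᵀ, both of determinant 1, bring H to diagonal form.
-- For c_s = q^s [s+1]_q the table has the closed form [n choose s]_q · [n-s-1]!!_q
-- (zero when n - s is odd), whence μ_m = [2m-1]!!_q; and D_i = q^C(2i,2) [2i]!_q,
-- which visibly divides D_{i'} for i ≤ i'.

open import Defs
open import Data.Nat as ℕ using (ℕ; zero; suc; _∸_; z≤n; s≤s)
import Data.Nat.Properties as ℕP
open import Data.Nat.Combinatorics using (_C_; nCk+nC[k+1]≡[n+1]C[k+1]; nC1≡n)
open import Data.Integer as ℤ using (ℤ; 0ℤ; 1ℤ)
import Data.Integer.Properties as ℤP
open import Data.Fin using (Fin; zero; suc; toℕ; punchIn)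
open import Data.Fin.Properties using (punchInᵢ≢i; toℕ<n; toℕ-injective)
open import Data.List using ([]; _∷_; map)
open import Data.Maybe using (Maybe; just; nothing)
open import Data.Product using (_,_)
open import Data.Sum using (_⊎_; inj₁; inj₂)
open import Data.Empty using (⊥-elim)
open import Relation.Binary.PropositionalEquality as ≡ using (_≡_; _≢_; refl)
open import Relation.Binary.Definitions using (tri<; tri≈; tri>)
open import Relation.Nullary using (Dec; yes; no)
open import Algebra.Bundles using (CommutativeRing)
open import Tactic.RingSolver.Core.AlmostCommutativeRing using (fromCommutativeRing)

-- ℤ[q] as a commutative ring.  Polynomials are coefficient lists; two are equal
-- when all their coefficients agree ('_≈P_'), which we wrap in a record so that
-- both polynomials can be recovered from a proof.
-- Congruences take the fixed operand explicitly: '_+P_' and '_*P_' compute by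
-- recursion, so Agda cannot reconstruct their arguments from a goal.
infix 4 _≈_
record _≈_ (p r : Poly) : Set where
  constructor coeffwise
  field at : p ≈P r
open _≈_ public

scale : ℤ → Poly → Poly
scale a = map (a ℤ.*_)

coeff-+ : ∀ p r k → coeff (p +P r) k ≡ coeff p k ℤ.+ coeff r k
coeff-+ []      r       k       = ≡.sym (ℤP.+-identityˡ _)
coeff-+ (a ∷ p) []      zero    = ≡.sym (ℤP.+-identityʳ a)
coeff-+ (a ∷ p) []      (suc k) = ≡.sym (ℤP.+-identityʳ _)
coeff-+ (a ∷ p) (b ∷ r) zero    = refl
coeff-+ (a ∷ p) (b ∷ r) (suc k) = coeff-+ p r k

coeff-neg : ∀ p k → coeff (-P p) k ≡ ℤ.- coeff p k
coeff-neg []      k       = refl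
coeff-neg (a ∷ p) zero    = refl
coeff-neg (a ∷ p) (suc k) = coeff-neg p k

coeff-scale : ∀ a r k → coeff (scale a r) k ≡ a ℤ.* coeff r k
coeff-scale a []      k       = ≡.sym (ℤP.*-zeroʳ a)
coeff-scale a (b ∷ r) zero    = refl
coeff-scale a (b ∷ r) (suc k) = coeff-scale a r k

≈-refl : ∀ {p} → p ≈ p
≈-refl = coeffwise (λ k → refl)

≈-sym : ∀ {p r} → p ≈ r → r ≈ p
≈-sym (coeffwise e) = coeffwise (λ k → ≡.sym (e k))

≈-trans : ∀ {p r s} → p ≈ r → r ≈ s → p ≈ s
≈-trans (coeffwise e) (coeffwise f) = coeffwise (λ k → ≡.trans (e k) (f k))

≡-to-≈ : ∀ {p r} → p ≡ r → p ≈ r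
≡-to-≈ refl = ≈-refl

∷-cong : ∀ {a b p r} → a ≡ b → p ≈ r → (a ∷ p) ≈ (b ∷ r)
∷-cong {a} {b} {p} {r} a≡b (coeffwise p≈r) = coeffwise pointwise
  where
  pointwise : (a ∷ p) ≈P (b ∷ r)
  pointwise zero    = a≡b
  pointwise (suc k) = p≈r k

+-cong : ∀ {p p' r r'} → p ≈ p' → r ≈ r' → (p +P r) ≈ (p' +P r')
+-cong {p} {p'} {r} {r'} (coeffwise e) (coeffwise f) = coeffwise λ k →
  ≡.trans (coeff-+ p r k) (≡.trans (≡.cong₂ ℤ._+_ (e k) (f k)) (≡.sym (coeff-+ p' r' k)))

neg-cong : ∀ {p p'} → p ≈ p' → (-P p) ≈ (-P p')
neg-cong {p} {p'} (coeffwise e) = coeffwise λ k →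
  ≡.trans (coeff-neg p k) (≡.trans (≡.cong ℤ.-_ (e k)) (≡.sym (coeff-neg p' k)))

scale-cong : ∀ a {r r'} → r ≈ r' → scale a r ≈ scale a r'
scale-cong a {r} {r'} (coeffwise e) = coeffwise λ k →
  ≡.trans (coeff-scale a r k) (≡.trans (≡.cong (a ℤ.*_) (e k)) (≡.sym (coeff-scale a r' k)))

+-assoc : ∀ p r s → ((p +P r) +P s) ≈ (p +P (r +P s))
+-assoc p r s = coeffwise λ k →
  ≡.trans (coeff-+ (p +P r) s k) (≡.trans (≡.cong (ℤ._+ coeff s k) (coeff-+ p r k))
  (≡.trans (ℤP.+-assoc (coeff p k) (coeff r k) (coeff s k))
  (≡.sym (≡.trans (coeff-+ p (r +P s) k) (≡.cong (λ z → coeff p k ℤ.+ z) (coeff-+ r s k))))))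

+-comm : ∀ p r → (p +P r) ≈ (r +P p)
+-comm p r = coeffwise λ k →
  ≡.trans (coeff-+ p r k) (≡.trans (ℤP.+-comm (coeff p k) (coeff r k)) (≡.sym (coeff-+ r p k)))

+-identityʳ : ∀ p → (p +P 0P) ≈ p
+-identityʳ p = coeffwise λ k → ≡.trans (coeff-+ p 0P k) (ℤP.+-identityʳ _)

+-inverseˡ : ∀ p → ((-P p) +P p) ≈ 0P
+-inverseˡ p = coeffwise λ k →
  ≡.trans (coeff-+ (-P p) p k) (≡.trans (≡.cong (ℤ._+ coeff p k) (coeff-neg p k)) (ℤP.+-inverseˡ (coeff p k)))

+-interchange : ∀ a b c d → ((a +P b) +P (c +P d)) ≈ ((a +P c) +P (b +P d))
+-interchange a b c d =
  ≈-trans (+-assoc a b (c +P d)) (≈-trans (+-cong (≈-refl {a}) middle) (≈-sym (+-assoc a c (b +P d))))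
  where
  middle : (b +P (c +P d)) ≈ (c +P (b +P d))
  middle = ≈-trans (≈-sym (+-assoc b c d))
           (≈-trans (+-cong (+-comm b c) (≈-refl {d})) (+-assoc c b d))

scale-distrib : ∀ a r s → scale a (r +P s) ≈ (scale a r +P scale a s)
scale-distrib a r s = coeffwise λ k →
  ≡.trans (coeff-scale a (r +P s) k) (≡.trans (≡.cong (a ℤ.*_) (coeff-+ r s k))
  (≡.trans (ℤP.*-distribˡ-+ a (coeff r k) (coeff s k))
  (≡.sym (≡.trans (coeff-+ (scale a r) (scale a s) k) (≡.cong₂ ℤ._+_ (coeff-scale a r k) (coeff-scale a s k))))))

scale-+ : ∀ a b r → scale (a ℤ.+ b) r ≈ (scale a r +P scale b r)
scale-+ a b r = coeffwise λ k →
  ≡.trans (coeff-scale (a ℤ.+ b) r k) (≡.trans (ℤP.*-distribʳ-+ (coeff r k) a b)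
  (≡.sym (≡.trans (coeff-+ (scale a r) (scale b r) k) (≡.cong₂ ℤ._+_ (coeff-scale a r k) (coeff-scale b r k)))))

scale-scale : ∀ a b r → scale a (scale b r) ≈ scale (a ℤ.* b) r
scale-scale a b r = coeffwise λ k →
  ≡.trans (coeff-scale a (scale b r) k) (≡.trans (≡.cong (a ℤ.*_) (coeff-scale b r k))
  (≡.trans (≡.sym (ℤP.*-assoc a b (coeff r k))) (≡.sym (coeff-scale (a ℤ.* b) r k))))

scale-zero : ∀ r → scale 0ℤ r ≈ 0P
scale-zero r = coeffwise λ k → coeff-scale 0ℤ r k

scale-one : ∀ r → scale 1ℤ r ≈ r
scale-one r = coeffwise λ k → ≡.trans (coeff-scale 1ℤ r k) (ℤP.*-identityˡ (coeff r k))

-- Multiplication, by induction on the first factor: (a ∷ p) * r = a·r + q·(p * r).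
-- Commutativity rests on the mirror-image recursion '*-∷ʳ' in the second factor.

shift-* : ∀ x s → ((0ℤ ∷ x) *P s) ≈ (0ℤ ∷ (x *P s))
shift-* x s = +-cong (scale-zero s) (≈-refl {0ℤ ∷ (x *P s)})

scale-* : ∀ a p r → scale a (p *P r) ≈ (scale a p *P r)
scale-* a []      r = ≈-refl
scale-* a (b ∷ p) r =
  ≈-trans (scale-distrib a (scale b r) (0ℤ ∷ (p *P r)))
          (+-cong (scale-scale a b r) (∷-cong (ℤP.*-zeroʳ a) (scale-* a p r)))

*-congˡ : ∀ p {r r'} → r ≈ r' → (p *P r) ≈ (p *P r')
*-congˡ []      e = ≈-refl
*-congˡ (a ∷ p) e = +-cong (scale-cong a e) (∷-cong refl (*-congˡ p e))

*-distribʳ : ∀ p p' r → ((p +P p') *P r) ≈ ((p *P r) +P (p' *P r))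
*-distribʳ []      p'       r = ≈-refl
*-distribʳ (a ∷ p) []       r = ≈-sym (+-identityʳ _)
*-distribʳ (a ∷ p) (b ∷ p') r =
  ≈-trans (+-cong (scale-+ a b r) (∷-cong refl (*-distribʳ p p' r)))
          (+-interchange (scale a r) (scale b r) (0ℤ ∷ (p *P r)) (0ℤ ∷ (p' *P r)))

*-distribˡ : ∀ p r s → (p *P (r +P s)) ≈ ((p *P r) +P (p *P s))
*-distribˡ []      r s = ≈-refl
*-distribˡ (a ∷ p) r s =
  ≈-trans (+-cong (scale-distrib a r s) (∷-cong refl (*-distribˡ p r s)))
          (+-interchange (scale a r) (scale a s) (0ℤ ∷ (p *P r)) (0ℤ ∷ (p *P s)))

*-assoc : ∀ p r s → ((p *P r) *P s) ≈ (p *P (r *P s))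
*-assoc []      r s = ≈-refl
*-assoc (a ∷ p) r s =
  ≈-trans (*-distribʳ (scale a r) (0ℤ ∷ (p *P r)) s)
          (+-cong (≈-sym (scale-* a r s)) (≈-trans (shift-* (p *P r) s) (∷-cong refl (*-assoc p r s))))

*-zeroʳ : ∀ p → (p *P 0P) ≈ 0P
*-zeroʳ []      = ≈-refl
*-zeroʳ (a ∷ p) = coeffwise λ { zero → refl ; (suc k) → at (*-zeroʳ p) k }

*-∷ʳ : ∀ p b r → (p *P (b ∷ r)) ≈ (scale b p +P (0ℤ ∷ (p *P r)))
*-∷ʳ []      b r = coeffwise λ { zero → refl ; (suc k) → refl }
*-∷ʳ (a ∷ p) b r =
  ∷-cong (≡.trans (ℤP.+-identityʳ _) (≡.trans (ℤP.*-comm a b) (≡.sym (ℤP.+-identityʳ _))))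
         (≈-trans (+-cong (≈-refl {scale a r}) (*-∷ʳ p b r))
         (≈-trans (≈-sym (+-assoc (scale a r) (scale b p) (0ℤ ∷ (p *P r))))
         (≈-trans (+-cong (+-comm (scale a r) (scale b p)) (≈-refl {0ℤ ∷ (p *P r)}))
                  (+-assoc (scale b p) (scale a r) (0ℤ ∷ (p *P r))))))

*-comm : ∀ p r → (p *P r) ≈ (r *P p)
*-comm []      r = ≈-sym (*-zeroʳ r)
*-comm (a ∷ p) r =
  ≈-trans (+-cong (≈-refl {scale a r}) (∷-cong refl (*-comm p r))) (≈-sym (*-∷ʳ r a p))

*-identityˡ : ∀ p → (1P *P p) ≈ p
*-identityˡ p = ≈-trans (+-cong (scale-one p) (coeffwise λ { zero → refl ; (suc k) → refl })) (+-identityʳ p)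

*-identityʳ : ∀ p → (p *P 1P) ≈ p
*-identityʳ p = ≈-trans (*-comm p 1P) (*-identityˡ p)

+-congˡ : ∀ p {r r'} → r ≈ r' → (p +P r) ≈ (p +P r')
+-congˡ p = +-cong (≈-refl {p})

+-congʳ : ∀ r {p p'} → p ≈ p' → (p +P r) ≈ (p' +P r)
+-congʳ r e = +-cong e (≈-refl {r})

*-congʳ : ∀ r {p p'} → p ≈ p' → (p *P r) ≈ (p' *P r)
*-congʳ r {p} {p'} e = ≈-trans (*-comm p r) (≈-trans (*-congˡ r e) (*-comm r p'))

*-cong : ∀ {p p' r r'} → p ≈ p' → r ≈ r' → (p *P r) ≈ (p' *P r')
*-cong {p} {p'} {r} {r'} e f = ≈-trans (*-congʳ r e) (*-congˡ p' f)

*-absorbs-0 : ∀ a {x} → x ≈ 0P → (a *P x) ≈ 0P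
*-absorbs-0 a x≈0 = ≈-trans (*-congˡ a x≈0) (*-zeroʳ a)

ℤ[q] : CommutativeRing _ _
ℤ[q] = record
  { Carrier = Poly ; _≈_ = _≈_ ; _+_ = _+P_ ; _*_ = _*P_ ; -_ = -P_ ; 0# = 0P ; 1# = 1P
  ; isCommutativeRing = record
    { isRing = record
      { +-isAbelianGroup = record
        { isGroup = record
          { isMonoid = record
            { isSemigroup = record
              { isMagma = record
                { isEquivalence = record { refl = ≈-refl ; sym = ≈-sym ; trans = ≈-trans }
                ; ∙-cong = +-cong }
              ; assoc = +-assoc }
            ; identity = (λ p → ≈-refl) , +-identityʳ }
          ; inverse = +-inverseˡ , (λ p → ≈-trans (+-comm p (-P p)) (+-inverseˡ p))
          ; ⁻¹-cong = neg-cong }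
        ; comm = +-comm }
      ; *-cong = *-cong
      ; *-assoc = *-assoc
      ; *-identity = *-identityˡ , *-identityʳ
      ; distrib = *-distribˡ , (λ p r s → *-distribʳ r s p) }
    ; *-comm = *-comm } }

-- Deciding whether a polynomial is zero, which the ring solver uses to
-- normalise coefficients.
isZero? : (p : Poly) → Maybe (0P ≈ p)
isZero? []      = just ≈-refl
isZero? (a ∷ p) with a ℤ.≟ 0ℤ | isZero? p
... | yes a≡0 | just 0≈p = just (coeffwise λ { zero → ≡.sym a≡0 ; (suc k) → at 0≈p k })
... | _       | _        = nothing

open CommutativeRing ℤ[q] using (_+_; _*_; -_; 0#; 1#)
open import Tactic.RingSolver.NonReflective (fromCommutativeRing ℤ[q] isZero?)
  using (solve; _⊕_; _⊜_; ⊝_; Κ) renaming (_⊗_ to infixl 7 _⊠_)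
open import Algebra.Properties.Semiring.Sum (CommutativeRing.semiring ℤ[q])
  using (sum; sum-syntax; sum-cong-≋; sum-remove; sum-replicate-zero; ∑-distrib-+; ∑-comm;
         *-distribˡ-sum; *-distribʳ-sum)
open import Relation.Binary.Reasoning.Setoid (CommutativeRing.setoid ℤ[q])

sumF≡sum : ∀ n (f : Fin n → Poly) → sumF n f ≡ sum f
sumF≡sum zero    f = ≡.refl
sumF≡sum (suc n) f = ≡.cong (f zero +_) (sumF≡sum n (λ i → f (suc i)))

sum-zero : ∀ {n} (f : Fin n → Poly) → (∀ i → f i ≈ 0#) → sum f ≈ 0#
sum-zero {n} f f≈0 = ≈-trans (sum-cong-≋ f≈0) (sum-replicate-zero n)

sumF-zero : ∀ n (f : Fin n → Poly) → (∀ i → f i ≈ 0#) → sumF n f ≈ 0#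
sumF-zero n f f≈0 = ≡.subst (_≈ 0#) (≡.sym (sumF≡sum n f)) (sum-zero f f≈0)

sum-single : ∀ {n} (f : Fin n → Poly) (i : Fin n) → (∀ k → k ≢ i → f k ≈ 0#) → sum f ≈ f i
sum-single {suc n} f i others≈0 = begin
  sum f                                  ≈⟨ sum-remove f ⟩
  f i + sum (λ k → f (punchIn i k))      ≈⟨ +-congˡ (f i) (sum-zero _ (λ k → others≈0 (punchIn i k) (punchInᵢ≢i i k))) ⟩
  f i + 0#                               ≈⟨ +-identityʳ (f i) ⟩
  f i                                    ∎

-- Linearity of Σₖ (f k + β g k) m k, used to apply the moment functional to the
-- three-term recurrence of the orthogonal polynomials.
sum-linear : ∀ {n} (f g m : Fin n → Poly) (β : Poly) →
  ∑[ k < n ] ((f k + β * g k) * m k) ≈ ∑[ k < n ] (f k * m k) + β * ∑[ k < n ] (g k * m k)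
sum-linear f g m β = begin
  ∑[ k < _ ] ((f k + β * g k) * m k)
    ≈⟨ sum-cong-≋ (λ k → distrib (f k) (g k) (m k) β) ⟩
  ∑[ k < _ ] (f k * m k + β * (g k * m k))
    ≈⟨ ∑-distrib-+ (λ k → f k * m k) (λ k → β * (g k * m k)) ⟩
  ∑[ k < _ ] (f k * m k) + ∑[ k < _ ] (β * (g k * m k))
    ≈⟨ +-congˡ (∑[ k < _ ] (f k * m k)) (≈-sym (*-distribˡ-sum β (λ k → g k * m k))) ⟩
  ∑[ k < _ ] (f k * m k) + β * ∑[ k < _ ] (g k * m k) ∎
  where
  distrib : ∀ x y z b → (x + b * y) * z ≈ x * z + b * (y * z)
  distrib = solve 4 (λ x y z b → ((x ⊕ b ⊠ y) ⊠ z) ⊜ (x ⊠ z ⊕ b ⊠ (y ⊠ z))) ≈-refl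

sum-linear₂ : ∀ {n} (f g h m : Fin n → Poly) (β γ : Poly) →
  ∑[ k < n ] ((f k + β * g k + γ * h k) * m k)
    ≈ ∑[ k < n ] (f k * m k) + β * ∑[ k < n ] (g k * m k) + γ * ∑[ k < n ] (h k * m k)
sum-linear₂ f g h m β γ =
  ≈-trans (sum-linear (λ k → f k + β * g k) h m γ)
          (+-congʳ (γ * ∑[ k < _ ] (h k * m k)) (sum-linear f g m β))

-- Determinants of unitriangular matrices, by Laplace expansion along the first
-- row (the definition of 'det').

minor : ∀ {n} → Mat (suc n) (suc n) → Fin (suc n) → Mat n n
minor A j r c = A (suc r) (punchIn j c)

laplaceTerm : ∀ {n} → Mat (suc n) (suc n) → Fin (suc n) → Poly
laplaceTerm {n} A j = sgn (toℕ j) * (A zero j * det n (minor A j))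

laplaceTerm-entry≈0 : ∀ {n} (A : Mat (suc n) (suc n)) j → A zero j ≈ 0# → laplaceTerm A j ≈ 0#
laplaceTerm-entry≈0 {n} A j a≈0 =
  *-absorbs-0 (sgn (toℕ j)) (*-congʳ (det n (minor A j)) a≈0)

laplaceTerm-minor≈0 : ∀ {n} (A : Mat (suc n) (suc n)) j → det n (minor A j) ≈ 0# → laplaceTerm A j ≈ 0#
laplaceTerm-minor≈0 A j d≈0 =
  *-absorbs-0 (sgn (toℕ j)) (*-absorbs-0 (A zero j) d≈0)

det-firstTerm : ∀ n (A : Mat (suc n) (suc n)) →
  (∀ j → laplaceTerm A (suc j) ≈ 0#) →
  det (suc n) A ≈ A zero zero * det n (minor A zero)
det-firstTerm n A later≈0 =
  ≈-trans (+-cong (*-identityˡ _) (sumF-zero n _ later≈0)) (+-identityʳ _)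

det-zeroColumn : ∀ n (A : Mat (suc n) (suc n)) → (∀ r → A r zero ≈ 0#) → det (suc n) A ≈ 0#
det-zeroColumn n A col≈0 =
  ≈-trans (det-firstTerm n A (later≈0 n A col≈0)) (*-congʳ (det n (minor A zero)) (col≈0 zero))
  where
  later≈0 : ∀ n (A : Mat (suc n) (suc n)) → (∀ r → A r zero ≈ 0#) →
    ∀ j → laplaceTerm A (suc j) ≈ 0#
  later≈0 (suc m) A col≈0 j =
    laplaceTerm-minor≈0 A (suc j) (det-zeroColumn m (minor A (suc j)) (λ r → col≈0 (suc r)))

det-unitLower : ∀ n (A : Mat n n) →
  (∀ r c → toℕ r ℕ.< toℕ c → A r c ≈ 0#) → (∀ r → A r r ≈ 1#) → det n A ≈ 1#
det-unitLower zero    A above≈0 diag≈1 = ≈-refl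
det-unitLower (suc n) A above≈0 diag≈1 = begin
  det (suc n) A                       ≈⟨ det-firstTerm n A later≈0 ⟩
  A zero zero * det n (minor A zero)  ≈⟨ *-cong (diag≈1 zero) minor≈1 ⟩
  1# * 1#                             ≈⟨ *-identityˡ 1# ⟩
  1#                                  ∎
  where
  minor≈1 : det n (minor A zero) ≈ 1#
  minor≈1 = det-unitLower n (minor A zero) (λ r c r<c → above≈0 (suc r) (suc c) (s≤s r<c)) (λ r → diag≈1 (suc r))
  later≈0 : ∀ j → laplaceTerm A (suc j) ≈ 0#
  later≈0 j = laplaceTerm-entry≈0 A (suc j) (above≈0 zero (suc j) (s≤s z≤n))

det-unitUpper : ∀ n (A : Mat n n) →
  (∀ r c → toℕ c ℕ.< toℕ r → A r c ≈ 0#) → (∀ r → A r r ≈ 1#) → det n A ≈ 1#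
det-unitUpper zero    A below≈0 diag≈1 = ≈-refl
det-unitUpper (suc n) A below≈0 diag≈1 = begin
  det (suc n) A                       ≈⟨ det-firstTerm n A (later≈0 n A below≈0) ⟩
  A zero zero * det n (minor A zero)  ≈⟨ *-cong (diag≈1 zero) minor≈1 ⟩
  1# * 1#                             ≈⟨ *-identityˡ 1# ⟩
  1#                                  ∎
  where
  minor≈1 : det n (minor A zero) ≈ 1#
  minor≈1 = det-unitUpper n (minor A zero) (λ r c c<r → below≈0 (suc r) (suc c) (s≤s c<r)) (λ r → diag≈1 (suc r))
  -- the minors of the later first-row entries keep a zero first column
  later≈0 : ∀ n (A : Mat (suc n) (suc n)) → (∀ r c → toℕ c ℕ.< toℕ r → A r c ≈ 0#) →
    ∀ j → laplaceTerm A (suc j) ≈ 0#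
  later≈0 (suc m) A below≈0 j =
    laplaceTerm-minor≈0 A (suc j) (det-zeroColumn m (minor A (suc j)) (λ r → below≈0 (suc r) zero (s≤s z≤n)))

-- Doubling by recursion, so that 'table (dbl (suc m))' unfolds two steps of the table.
dbl : ℕ → ℕ
dbl zero    = zero
dbl (suc m) = suc (suc (dbl m))

dbl≡2* : ∀ m → dbl m ≡ 2 ℕ.* m
dbl≡2* zero    = refl
dbl≡2* (suc m) = ≡.cong suc (≡.trans (≡.cong suc (dbl≡2* m)) (≡.sym (ℕP.+-suc m (m ℕ.+ 0))))

dbl-mono : ∀ {l i} → l ℕ.< i → dbl l ℕ.< dbl i
dbl-mono {zero}  {suc i} _         = s≤s z≤n
dbl-mono {suc l} {suc i} (s≤s l<i) = s≤s (s≤s (dbl-mono l<i))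

-- Moments of a Stieltjes continued fraction 1/(1 − c₀x/(1 − c₁x/(1 − ⋯))) and the
-- diagonalisation of their Hankel matrix, for an arbitrary coefficient sequence c.
module Stieltjes (c : ℕ → Poly) where

  -- The Stieltjes table: table n s is the total weight of paths with n up/down steps
  -- from height 0 to height s, a down step from height s+1 weighing c s.
  table : ℕ → ℕ → Poly
  table zero    zero    = 1#
  table zero    (suc s) = 0#
  table (suc n) zero    = c 0 * table n 1
  table (suc n) (suc s) = table n s + c (suc s) * table n (suc (suc s))

  moment : ℕ → Poly
  moment m = table (dbl m) 0

  -- The table is lower unitriangular: height s needs at least s steps, and the
  -- only path reaching it in s steps has weight 1.
  table-above : ∀ n s → n ℕ.< s → table n s ≈ 0#
  table-above zero    (suc s) _         = ≈-refl
  table-above (suc n) (suc s) (s≤s n<s) =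
    +-cong (table-above n s n<s)
           (*-absorbs-0 (c (suc s)) (table-above n (suc (suc s)) (ℕP.m<n⇒m<1+n (ℕP.m<n⇒m<1+n n<s))))

  table-diagonal : ∀ n → table n n ≈ 1#
  table-diagonal zero    = ≈-refl
  table-diagonal (suc n) =
    ≈-trans (+-cong (table-diagonal n)
                    (*-absorbs-0 (c (suc n)) (table-above n (suc (suc n)) (ℕP.m<n⇒m<1+n (ℕP.n<1+n n)))))
            (+-identityʳ 1#)

  -- Contraction to a Jacobi continued fraction: the even rows and columns of the
  -- table satisfy a three-term recurrence with coefficients b and λ.
  b : ℕ → Poly
  b zero    = c 0
  b (suc i) = c (suc (dbl i)) + c (suc (suc (dbl i)))

  λ' : ℕ → Poly
  λ' i = c (dbl i) * c (suc (dbl i))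

  D : ℕ → Poly
  D zero    = 1#
  D (suc i) = λ' i * D i

  L : ℕ → ℕ → Poly
  L l i = table (dbl l) (dbl i)

  L-step₀ : ∀ l → L (suc l) 0 ≈ b 0 * L l 0 + λ' 0 * L l 1
  L-step₀ l = solve 4 (λ c₀ c₁ x y → (c₀ ⊠ (x ⊕ c₁ ⊠ y)) ⊜ (c₀ ⊠ x ⊕ (c₀ ⊠ c₁) ⊠ y)) ≈-refl
    (c 0) (c 1) (L l 0) (L l 1)

  L-step : ∀ l i → L (suc l) (suc i) ≈ L l i + b (suc i) * L l (suc i) + λ' (suc i) * L l (suc (suc i))
  L-step l i = solve 6 (λ x y z u v w → ((x ⊕ u ⊠ y) ⊕ v ⊠ (y ⊕ w ⊠ z)) ⊜ (x ⊕ (u ⊕ v) ⊠ y ⊕ (v ⊠ w) ⊠ z)) ≈-refl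
    (L l i) (L l (suc i)) (L l (suc (suc i)))
    (c (suc (dbl i))) (c (suc (suc (dbl i)))) (c (suc (suc (suc (dbl i)))))

  L-above : ∀ l i → l ℕ.< i → L l i ≈ 0#
  L-above l i l<i = table-above (dbl l) (dbl i) (dbl-mono l<i)

  L-diagonal : ∀ i → L i i ≈ 1#
  L-diagonal i = table-diagonal (dbl i)

  timesX : (ℕ → Poly) → ℕ → Poly
  timesX p zero    = 0#
  timesX p (suc k) = p k

  -- P i k is the coefficient of x^k in the monic orthogonal polynomial p_i:
  -- p₀ = 1,  p₁ = (x − b₀) p₀,  p_{i+2} = (x − b_{i+1}) p_{i+1} − λ_i p_i.
  P : ℕ → ℕ → Poly
  P zero          zero    = 1#
  P zero          (suc k) = 0#
  P (suc zero)    k       = timesX (P 0) k + - b 0 * P 0 k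
  P (suc (suc i)) k       = timesX (P (suc i)) k + - b (suc i) * P (suc i) k + - λ' i * P i k

  P-above : ∀ i k → i ℕ.< k → P i k ≈ 0#
  P-above zero          (suc k)       _          = ≈-refl
  P-above (suc zero)    (suc zero)    (s≤s ())
  P-above (suc zero)    (suc (suc k)) _          = *-zeroʳ (- b 0)
  P-above (suc (suc i)) (suc k)       (s≤s i+1<k) =
    +-cong (+-cong (P-above (suc i) k i+1<k) (*-absorbs-0 (- b (suc i)) (P-above (suc i) (suc k) (ℕP.m<n⇒m<1+n i+1<k))))
           (*-absorbs-0 (- λ' i) (P-above i (suc k) (ℕP.m<n⇒m<1+n (ℕP.<-trans (ℕP.n<1+n i) i+1<k))))

  P-diagonal : ∀ i → P i i ≈ 1#
  P-diagonal zero          = ≈-refl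
  P-diagonal (suc zero)    = ≈-trans (+-congˡ 1# (*-zeroʳ (- b 0))) (+-identityʳ 1#)
  P-diagonal (suc (suc i)) =
    ≈-trans (+-cong (+-cong (P-diagonal (suc i)) (*-absorbs-0 (- b (suc i)) (P-above (suc i) (suc (suc i)) ℕP.≤-refl)))
                    (*-absorbs-0 (- λ' i) (P-above i (suc (suc i)) (ℕP.m<n⇒m<1+n ℕP.≤-refl))))
            (≈-trans (+-identityʳ (1# + 0#)) (+-identityʳ 1#))

  momentsFrom : ∀ {N} → ℕ → Fin N → Poly
  momentsFrom l k = moment (toℕ k ℕ.+ l)

  -- The moment functional applied to x^l · p_i, with p_i truncated to degree < N.
  pairing : ℕ → ℕ → ℕ → Poly
  pairing N i l = ∑[ k < N ] (P i (toℕ k) * momentsFrom l k)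

  pairing-timesX : ∀ N (p : ℕ → Poly) l →
    ∑[ k < suc N ] (timesX p (toℕ k) * moment (toℕ k ℕ.+ l)) ≈ ∑[ k < N ] (p (toℕ k) * moment (toℕ k ℕ.+ suc l))
  pairing-timesX N p l =
    sum-cong-≋ {N} (λ k → *-congˡ (p (toℕ k)) (≡-to-≈ (≡.cong moment (≡.sym (ℕP.+-suc (toℕ k) l)))))

  pairing≈ : ∀ i N l → i ℕ.< N → pairing N i l ≈ D i * L l i
  pairing≈ zero (suc N) l _ =   -- p₀ = 1, so only the term k = 0 survives
    ≈-trans (+-congˡ (1# * moment l) (sum-zero {N} (λ k → 0# * moment (suc (toℕ k) ℕ.+ l)) (λ k → ≈-refl)))
            (+-identityʳ (1# * moment l))
  pairing≈ (suc zero) (suc N) l (s≤s 0<N) = begin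
    pairing (suc N) 1 l
      ≈⟨ sum-linear {suc N} (λ k → timesX (P 0) (toℕ k)) (λ k → P 0 (toℕ k)) (momentsFrom l) (- b 0) ⟩
    ∑[ k < suc N ] (timesX (P 0) (toℕ k) * moment (toℕ k ℕ.+ l)) + - b 0 * pairing (suc N) 0 l
      ≈⟨ +-cong (pairing-timesX N (P 0) l) (*-congˡ (- b 0) (pairing≈ 0 (suc N) l (s≤s z≤n))) ⟩
    pairing N 0 (suc l) + - b 0 * (D 0 * L l 0)
      ≈⟨ +-congʳ (- b 0 * (D 0 * L l 0)) (≈-trans (pairing≈ 0 N (suc l) 0<N) (*-congˡ (D 0) (L-step₀ l))) ⟩
    D 0 * (b 0 * L l 0 + λ' 0 * L l 1) + - b 0 * (D 0 * L l 0)
      ≈⟨ solve 5 (λ d β λ₀ x y → (d ⊠ (β ⊠ x ⊕ λ₀ ⊠ y) ⊕ (⊝ β) ⊠ (d ⊠ x)) ⊜ ((λ₀ ⊠ d) ⊠ y)) ≈-refl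
           (D 0) (b 0) (λ' 0) (L l 0) (L l 1) ⟩
    D 1 * L l 1 ∎
  pairing≈ (suc (suc i)) (suc N) l (s≤s i+1<N) = begin
    pairing (suc N) (suc (suc i)) l
      ≈⟨ sum-linear₂ {suc N} (λ k → timesX (P (suc i)) (toℕ k)) (λ k → P (suc i) (toℕ k)) (λ k → P i (toℕ k))
                     (momentsFrom l) (- b (suc i)) (- λ' i) ⟩
    ∑[ k < suc N ] (timesX (P (suc i)) (toℕ k) * moment (toℕ k ℕ.+ l))
      + - b (suc i) * pairing (suc N) (suc i) l + - λ' i * pairing (suc N) i l
      ≈⟨ +-cong (+-cong (pairing-timesX N (P (suc i)) l)
                        (*-congˡ (- b (suc i)) (pairing≈ (suc i) (suc N) l (s≤s (ℕP.<⇒≤ i+1<N)))))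
                (*-congˡ (- λ' i) (pairing≈ i (suc N) l (ℕP.<-trans (ℕP.n<1+n i) (s≤s (ℕP.<⇒≤ i+1<N))))) ⟩
    pairing N (suc i) (suc l) + - b (suc i) * (D (suc i) * L l (suc i)) + - λ' i * (D i * L l i)
      ≈⟨ +-congʳ (- λ' i * (D i * L l i)) (+-congʳ (- b (suc i) * (D (suc i) * L l (suc i)))
           (≈-trans (pairing≈ (suc i) N (suc l) i+1<N) (*-congˡ (D (suc i)) (L-step l i)))) ⟩
    D (suc i) * (L l i + b (suc i) * L l (suc i) + λ' (suc i) * L l (suc (suc i)))
      + - b (suc i) * (D (suc i) * L l (suc i)) + - λ' i * (D i * L l i)
      ≈⟨ solve 7 (λ λᵢ d x β y λ₁ z →
             ((λᵢ ⊠ d) ⊠ (x ⊕ β ⊠ y ⊕ λ₁ ⊠ z) ⊕ (⊝ β) ⊠ ((λᵢ ⊠ d) ⊠ y) ⊕ (⊝ λᵢ) ⊠ (d ⊠ x))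
           ⊜ (λ₁ ⊠ (λᵢ ⊠ d) ⊠ z)) ≈-refl
           (λ' i) (D i) (L l i) (b (suc i)) (L l (suc i)) (λ' (suc i)) (L l (suc (suc i))) ⟩
    D (suc (suc i)) * L l (suc (suc i)) ∎

  -- Entry (i, j) of P H Pᵀ, where H = (moment (k + l))_{k,l < N} is the Hankel matrix.
  conjHankel : ∀ N → Fin N → Fin N → Poly
  conjHankel N i j = ∑[ l < N ] (pairing N (toℕ i) (toℕ l) * P (toℕ j) (toℕ l))

  private
    pairingTerm≈ : ∀ N (i l : Fin N) j →
      pairing N (toℕ i) (toℕ l) * P j (toℕ l) ≈ D (toℕ i) * L (toℕ l) (toℕ i) * P j (toℕ l)
    pairingTerm≈ N i l j = *-congʳ (P j (toℕ l)) (pairing≈ (toℕ i) N (toℕ l) (toℕ<n i))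

    term≈0 : ∀ i j l → (l ℕ.< i ⊎ j ℕ.< l) → D i * L l i * P j l ≈ 0#
    term≈0 i j l (inj₁ l<i) = *-congʳ (P j l) (*-absorbs-0 (D i) (L-above l i l<i))
    term≈0 i j l (inj₂ j<l) = *-absorbs-0 (D i * L l i) (P-above j l j<l)

  conjHankel-below : ∀ N (i j : Fin N) → toℕ j ℕ.< toℕ i → conjHankel N i j ≈ 0#
  conjHankel-below N i j j<i = sum-zero _ λ l → ≈-trans (pairingTerm≈ N i l (toℕ j)) (term≈0 _ _ _ (split l))
    where
    split : ∀ l → toℕ l ℕ.< toℕ i ⊎ toℕ j ℕ.< toℕ l
    split l with toℕ l ℕ.<? toℕ i
    ... | yes l<i = inj₁ l<i
    ... | no  l≮i = inj₂ (ℕP.<-≤-trans j<i (ℕP.≮⇒≥ l≮i))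

  conjHankel-diagonal : ∀ N (i : Fin N) → conjHankel N i i ≈ D (toℕ i)
  conjHankel-diagonal N i = begin
    conjHankel N i i
      ≈⟨ sum-single _ i (λ l l≢i → ≈-trans (pairingTerm≈ N i l (toℕ i)) (term≈0 _ _ _ (split l l≢i))) ⟩
    pairing N (toℕ i) (toℕ i) * P (toℕ i) (toℕ i)
      ≈⟨ pairingTerm≈ N i i (toℕ i) ⟩
    D (toℕ i) * L (toℕ i) (toℕ i) * P (toℕ i) (toℕ i)
      ≈⟨ *-cong (*-congˡ (D (toℕ i)) (L-diagonal (toℕ i))) (P-diagonal (toℕ i)) ⟩
    D (toℕ i) * 1# * 1#
      ≈⟨ ≈-trans (*-identityʳ (D (toℕ i) * 1#)) (*-identityʳ (D (toℕ i))) ⟩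
    D (toℕ i) ∎
    where
    split : ∀ l → l ≢ i → toℕ l ℕ.< toℕ i ⊎ toℕ i ℕ.< toℕ l
    split l l≢i with ℕP.<-cmp (toℕ l) (toℕ i)
    ... | tri< l<i _ _ = inj₁ l<i
    ... | tri≈ _ l≡i _ = ⊥-elim (l≢i (toℕ-injective l≡i))
    ... | tri> _ _ i<l = inj₂ i<l

  conjHankel-symmetric : ∀ N (i j : Fin N) → conjHankel N i j ≈ conjHankel N j i
  conjHankel-symmetric N i j = begin
    ∑[ l < N ] (∑[ k < N ] (p i k * momentsFrom (toℕ l) k) * p j l)
      ≈⟨ sum-cong-≋ (λ l → *-distribʳ-sum (p j l) (λ k → p i k * momentsFrom (toℕ l) k)) ⟩
    ∑[ l < N ] ∑[ k < N ] (p i k * momentsFrom (toℕ l) k * p j l)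
      ≈⟨ ∑-comm (λ l k → p i k * momentsFrom (toℕ l) k * p j l) ⟩
    ∑[ k < N ] ∑[ l < N ] (p i k * momentsFrom (toℕ l) k * p j l)
      ≈⟨ sum-cong-≋ (λ k → sum-cong-≋ (λ l → swap k l)) ⟩
    ∑[ k < N ] ∑[ l < N ] (p j l * momentsFrom (toℕ k) l * p i k)
      ≈⟨ ≈-sym (sum-cong-≋ (λ k → *-distribʳ-sum (p i k) (λ l → p j l * momentsFrom (toℕ k) l))) ⟩
    ∑[ k < N ] (∑[ l < N ] (p j l * momentsFrom (toℕ k) l) * p i k) ∎
    where
    p : Fin N → Fin N → Poly
    p i k = P (toℕ i) (toℕ k)
    swap : ∀ k l → p i k * momentsFrom (toℕ l) k * p j l ≈ p j l * momentsFrom (toℕ k) l * p i k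
    swap k l = ≈-trans (*-congʳ (p j l) (*-congˡ (p i k) (≡-to-≈ (≡.cong moment (ℕP.+-comm (toℕ k) (toℕ l))))))
      (solve 3 (λ x m y → (x ⊠ m ⊠ y) ⊜ (y ⊠ m ⊠ x)) ≈-refl (p i k) (moment (toℕ l ℕ.+ toℕ k)) (p j l))

  conjHankel-offDiagonal : ∀ N (i j : Fin N) → toℕ i ≢ toℕ j → conjHankel N i j ≈ 0#
  conjHankel-offDiagonal N i j i≢j with ℕP.<-cmp (toℕ i) (toℕ j)
  ... | tri< i<j _ _ = ≈-trans (conjHankel-symmetric N i j) (conjHankel-below N j i i<j)
  ... | tri≈ _ i≡j _ = ⊥-elim (i≢j i≡j)
  ... | tri> _ _ j<i = conjHankel-below N i j j<i

-- The specialisation c_s = q^s [s+1]_q.  Its Stieltjes table is evaluated with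
-- Gaussian binomials, giving the moments [2m-1]!!_q; the products D_i are
-- evaluated directly.

qInt-suc : ∀ m → qInt (suc m) ≈ 1# + qP * qInt m
qInt-suc zero    = ≈-sym (≈-trans (+-congˡ 1# (*-zeroʳ qP)) (+-identityʳ 1#))
qInt-suc (suc m) = begin
  qP * qP ^P m + qInt (suc m)          ≈⟨ +-congˡ (qP * qP ^P m) (qInt-suc m) ⟩
  qP * qP ^P m + (1# + qP * qInt m)    ≈⟨ solve 4 (λ q x i o → (q ⊠ x ⊕ (o ⊕ q ⊠ i)) ⊜ (o ⊕ q ⊠ (x ⊕ i))) ≈-refl
                                              qP (qP ^P m) (qInt m) 1# ⟩
  1# + qP * qInt (suc m) ∎

qbin : ℕ → ℕ → Poly
qbin n       zero    = 1#
qbin zero    (suc k) = 0#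
qbin (suc n) (suc k) = qbin n k + qP ^P suc k * qbin n (suc k)

qbin-above : ∀ n k → n ℕ.< k → qbin n k ≈ 0#
qbin-above zero    (suc k) _         = ≈-refl
qbin-above (suc n) (suc k) (s≤s n<k) =
  +-cong (qbin-above n k n<k)
         (*-absorbs-0 (qP ^P suc k) (qbin-above n (suc k) (ℕP.m<n⇒m<1+n n<k)))

qbin-one : ∀ n → qbin n 1 ≈ qInt n
qbin-one zero    = ≈-refl
qbin-one (suc n) = begin
  1# + qP * 1# * qbin n 1   ≈⟨ +-congˡ 1# (*-cong (*-identityʳ qP) (qbin-one n)) ⟩
  1# + qP * qInt n          ≈⟨ ≈-sym (qInt-suc n) ⟩
  qInt (suc n)              ∎

-- The algebra behind one step of the absorption identity, with Q = q^{k+1},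
-- I = [k+1], T = [n-k] and J = [n-k-1]; note [k+2] = Q + I.
absorption-step : ∀ B X Y Q I T J →
  B * T ≈ I * X → X * J ≈ (Q + I) * Y → T ≈ 1# + qP * J →
  (B + Q * X) * T ≈ (Q + I) * (X + qP * Q * Y)
absorption-step B X Y Q I T J BT≈IX XJ≈[Q+I]Y T≈1+qJ = begin
  (B + Q * X) * T
    ≈⟨ solve 4 (λ b q x t → ((b ⊕ q ⊠ x) ⊠ t) ⊜ (b ⊠ t ⊕ (q ⊠ x) ⊠ t)) ≈-refl B Q X T ⟩
  B * T + Q * X * T
    ≈⟨ +-cong BT≈IX (*-congˡ (Q * X) T≈1+qJ) ⟩
  I * X + Q * X * (1# + qP * J)
    ≈⟨ solve 5 (λ i x q p j → (i ⊠ x ⊕ q ⊠ x ⊠ (Κ 1# ⊕ p ⊠ j)) ⊜ ((q ⊕ i) ⊠ x ⊕ p ⊠ q ⊠ (x ⊠ j))) ≈-refl I X Q qP J ⟩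
  (Q + I) * X + qP * Q * (X * J)
    ≈⟨ +-congˡ ((Q + I) * X) (*-congˡ (qP * Q) XJ≈[Q+I]Y) ⟩
  (Q + I) * X + qP * Q * ((Q + I) * Y)
    ≈⟨ solve 5 (λ q i x p y → ((q ⊕ i) ⊠ x ⊕ p ⊠ q ⊠ ((q ⊕ i) ⊠ y)) ⊜ ((q ⊕ i) ⊠ (x ⊕ p ⊠ q ⊠ y))) ≈-refl Q I X qP Y ⟩
  (Q + I) * (X + qP * Q * Y) ∎

qbin-absorption : ∀ n k → qbin n k * qInt (n ∸ k) ≈ qInt (suc k) * qbin n (suc k)
qbin-absorption zero    zero    = ≈-trans (*-zeroʳ 1#) (≈-sym (*-zeroʳ (qInt 1)))
qbin-absorption zero    (suc k) = ≈-sym (*-zeroʳ (qInt (suc (suc k))))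
qbin-absorption (suc n) zero    = begin
  1# * qInt (suc n)          ≈⟨ *-identityˡ (qInt (suc n)) ⟩
  qInt (suc n)               ≈⟨ ≈-sym (qbin-one (suc n)) ⟩
  qbin (suc n) 1             ≈⟨ ≈-sym (*-identityˡ (qbin (suc n) 1)) ⟩
  qInt 1 * qbin (suc n) 1    ∎
qbin-absorption (suc n) (suc k) with k ℕ.<? n
... | yes k<n = absorption-step (qbin n k) (qbin n (suc k)) (qbin n (suc (suc k))) (qP ^P suc k) (qInt (suc k))
                  (qInt (n ∸ k)) (qInt (n ∸ suc k))
                  (qbin-absorption n k) (qbin-absorption n (suc k))
                  (≈-trans (≡-to-≈ (≡.cong qInt (ℕP.+-∸-assoc 1 k<n))) (qInt-suc (n ∸ suc k)))
... | no  k≮n = begin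
  qbin (suc n) (suc k) * qInt (n ∸ k)   ≈⟨ *-congˡ (qbin (suc n) (suc k)) (≡-to-≈ (≡.cong qInt (ℕP.m≤n⇒m∸n≡0 n≤k))) ⟩
  qbin (suc n) (suc k) * 0#             ≈⟨ *-zeroʳ (qbin (suc n) (suc k)) ⟩
  0#                                    ≈⟨ ≈-sym (*-zeroʳ (qInt (suc (suc k)))) ⟩
  qInt (suc (suc k)) * 0#               ≈⟨ *-congˡ (qInt (suc (suc k))) (≈-sym (qbin-above (suc n) (suc (suc k)) (s≤s (s≤s n≤k)))) ⟩
  qInt (suc (suc k)) * qbin (suc n) (suc (suc k)) ∎
  where
  n≤k = ℕP.≮⇒≥ k≮n

weight : ℕ → Poly
weight s = qP ^P s * qInt (suc s)

open Stieltjes weight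

-- [n-1]!!_q for even n, and 0 for odd n: df (2m) = [1][3]⋯[2m-1], df (2m+1) = 0.
df : ℕ → Poly
df zero                = 1#
df (suc zero)          = 0#
df (suc (suc k))       = qInt (suc k) * df k

-- df (n+1) = [n]_q df (n-1), also for n = 0.
df-step : ∀ n → qInt n * df (n ∸ 1) ≈ df (suc n)
df-step zero    = ≈-refl
df-step (suc m) = ≈-refl

-- The inductive step of the closed form below: absorption with a factor [n-s-1] of df (n-s).
closedForm-step : ∀ n s →
  qInt (suc (suc s)) * qbin n (suc (suc s)) * df (n ∸ suc (suc s)) ≈ qbin n (suc s) * df (n ∸ s)
closedForm-step n s with suc s ℕ.<? n
... | yes s+1<n = begin
  qInt (suc (suc s)) * qbin n (suc (suc s)) * df t  ≈⟨ *-congʳ (df t) (≈-sym (qbin-absorption n (suc s))) ⟩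
  qbin n (suc s) * qInt (n ∸ suc s) * df t          ≈⟨ *-assoc (qbin n (suc s)) (qInt (n ∸ suc s)) (df t) ⟩
  qbin n (suc s) * (qInt (n ∸ suc s) * df t)        ≈⟨ *-congˡ (qbin n (suc s)) [n-s-1]df≈df ⟩
  qbin n (suc s) * df (n ∸ s)                       ∎
  where
  t = n ∸ suc (suc s)
  n∸[s+1]≡1+t : n ∸ suc s ≡ suc t
  n∸[s+1]≡1+t = ℕP.+-∸-assoc 1 s+1<n
  n∸s≡2+t : n ∸ s ≡ suc (suc t)
  n∸s≡2+t = ≡.trans (ℕP.+-∸-assoc 1 (ℕP.<⇒≤ s+1<n)) (≡.cong suc n∸[s+1]≡1+t)
  [n-s-1]df≈df : qInt (n ∸ suc s) * df t ≈ df (n ∸ s)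
  [n-s-1]df≈df = ≡-to-≈ (≡.trans (≡.cong (λ m → qInt m * df t) n∸[s+1]≡1+t) (≡.cong df (≡.sym n∸s≡2+t)))
... | no s+1≮n = ≈-trans left≈0 (≈-sym (right≈0 (ℕP.m≤n⇒m<n∨m≡n n≤s+1)))
  where
  n≤s+1 : n ℕ.≤ suc s
  n≤s+1 = ℕP.≮⇒≥ s+1≮n
  left≈0 : qInt (suc (suc s)) * qbin n (suc (suc s)) * df (n ∸ suc (suc s)) ≈ 0#
  left≈0 = *-congʳ (df (n ∸ suc (suc s))) (*-absorbs-0 (qInt (suc (suc s))) (qbin-above n (suc (suc s)) (s≤s n≤s+1)))
  -- either the binomial vanishes, or n - s = 1 and df 1 = 0
  right≈0 : n ℕ.< suc s ⊎ n ≡ suc s → qbin n (suc s) * df (n ∸ s) ≈ 0#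
  right≈0 (inj₁ n<s+1) = *-congʳ (df (n ∸ s)) (qbin-above n (suc s) n<s+1)
  right≈0 (inj₂ n≡s+1) = ≡.subst (λ m → qbin m (suc s) * df (m ∸ s) ≈ 0#) (≡.sym n≡s+1)
    (*-absorbs-0 (qbin (suc s) (suc s)) (≡-to-≈ (≡.cong df (ℕP.m+n∸n≡m 1 s))))

table-closed : ∀ n s → table n s ≈ qbin n s * df (n ∸ s)
table-closed zero    zero    = ≈-sym (*-identityˡ 1#)
table-closed zero    (suc s) = ≈-refl
table-closed (suc n) zero    = begin
  weight 0 * table n 1               ≈⟨ *-cong (*-identityˡ (qInt 1)) (table-closed n 1) ⟩
  1# * (qbin n 1 * df (n ∸ 1))       ≈⟨ *-identityˡ (qbin n 1 * df (n ∸ 1)) ⟩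
  qbin n 1 * df (n ∸ 1)              ≈⟨ *-congʳ (df (n ∸ 1)) (qbin-one n) ⟩
  qInt n * df (n ∸ 1)                ≈⟨ df-step n ⟩
  df (suc n)                         ≈⟨ ≈-sym (*-identityˡ (df (suc n))) ⟩
  1# * df (suc n)                    ∎
table-closed (suc n) (suc s) = begin
  table n s + qP ^P suc s * qInt (suc (suc s)) * table n (suc (suc s))
    ≈⟨ +-cong (table-closed n s) (*-congˡ (weight (suc s)) (table-closed n (suc (suc s)))) ⟩
  qbin n s * df (n ∸ s) + qP ^P suc s * qInt (suc (suc s)) * (qbin n (suc (suc s)) * df (n ∸ suc (suc s)))
    ≈⟨ +-congˡ (qbin n s * df (n ∸ s)) (solve 4 (λ Q I Y F → ((Q ⊠ I) ⊠ (Y ⊠ F)) ⊜ (Q ⊠ (I ⊠ Y ⊠ F))) ≈-refl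
          (qP ^P suc s) (qInt (suc (suc s))) (qbin n (suc (suc s))) (df (n ∸ suc (suc s)))) ⟩
  qbin n s * df (n ∸ s) + qP ^P suc s * (qInt (suc (suc s)) * qbin n (suc (suc s)) * df (n ∸ suc (suc s)))
    ≈⟨ +-congˡ (qbin n s * df (n ∸ s)) (*-congˡ (qP ^P suc s) (closedForm-step n s)) ⟩
  qbin n s * df (n ∸ s) + qP ^P suc s * (qbin n (suc s) * df (n ∸ s))
    ≈⟨ solve 4 (λ B F Q X → (B ⊠ F ⊕ Q ⊠ (X ⊠ F)) ⊜ ((B ⊕ Q ⊠ X) ⊠ F)) ≈-refl
         (qbin n s) (df (n ∸ s)) (qP ^P suc s) (qbin n (suc s)) ⟩
  (qbin n s + qP ^P suc s * qbin n (suc s)) * df (n ∸ s) ∎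

df-dbl : ∀ m → df (dbl m) ≈ qDFact m
df-dbl zero    = ≈-refl
df-dbl (suc m) = *-cong (≡-to-≈ (≡.cong (λ k → qInt (suc k)) (dbl≡2* m))) (df-dbl m)

moment-closed : ∀ m → moment m ≈ qDFact m
moment-closed m = ≈-trans (table-closed (dbl m) 0) (≈-trans (*-identityˡ (df (dbl m))) (df-dbl m))

^P-+ : ∀ a b → qP ^P (a ℕ.+ b) ≈ qP ^P a * qP ^P b
^P-+ zero    b = ≈-sym (*-identityˡ (qP ^P b))
^P-+ (suc a) b = ≈-trans (*-congˡ qP (^P-+ a b)) (≈-sym (*-assoc qP (qP ^P a) (qP ^P b)))

choose2-step : ∀ m → suc (suc m) C 2 ≡ suc m ℕ.+ (m ℕ.+ m C 2)
choose2-step m = ≡.sym (≡.trans (≡.cong₂ ℕ._+_ (≡.sym (nC1≡n (suc m)))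
                                              (≡.trans (≡.cong (ℕ._+ m C 2) (≡.sym (nC1≡n m))) (nCk+nC[k+1]≡[n+1]C[k+1] m 1)))
                                (nCk+nC[k+1]≡[n+1]C[k+1] (suc m) 1))

D-closed : ∀ i → D i ≈ qP ^P ((2 ℕ.* i) C 2) * qFact (2 ℕ.* i)
D-closed i = ≈-trans (D-dbl i) (≡-to-≈ (≡.cong (λ m → qP ^P (m C 2) * qFact m) (dbl≡2* i)))
  where
  D-dbl : ∀ i → D i ≈ qP ^P (dbl i C 2) * qFact (dbl i)
  D-dbl zero    = ≈-sym (*-identityˡ 1#)
  D-dbl (suc i) = begin
    weight m * weight (suc m) * D i
      ≈⟨ *-congˡ (weight m * weight (suc m)) (D-dbl i) ⟩
    qP ^P m * qInt (suc m) * (qP ^P suc m * qInt (suc (suc m))) * (qP ^P (m C 2) * qFact m)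
      ≈⟨ solve 6 (λ a b x y z f → ((a ⊠ y) ⊠ (b ⊠ x) ⊠ (z ⊠ f)) ⊜ ((b ⊠ (a ⊠ z)) ⊠ (x ⊠ (y ⊠ f)))) ≈-refl
           (qP ^P m) (qP ^P suc m) (qInt (suc (suc m))) (qInt (suc m)) (qP ^P (m C 2)) (qFact m) ⟩
    qP ^P suc m * (qP ^P m * qP ^P (m C 2)) * qFact (suc (suc m))
      ≈⟨ *-congʳ (qFact (suc (suc m))) (≈-sym (≈-trans (^P-+ (suc m) (m ℕ.+ m C 2)) (*-congˡ (qP ^P suc m) (^P-+ m (m C 2))))) ⟩
    qP ^P (suc m ℕ.+ (m ℕ.+ m C 2)) * qFact (suc (suc m))
      ≈⟨ ≡-to-≈ (≡.cong (λ e → qP ^P e * qFact (suc (suc m))) (≡.sym (choose2-step m))) ⟩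
    qP ^P (suc (suc m) C 2) * qFact (suc (suc m)) ∎
    where
    m = dbl i

D-divides : ∀ {j i} → j ℕ.≤ i → D j ∣P D i
D-divides {j} {i} j≤i = ≡.subst (λ m → D j ∣P D m) (ℕP.m∸n+n≡m j≤i) (multiple (i ∸ j))
  where
  multiple : ∀ d → D j ∣P D (d ℕ.+ j)
  multiple zero    = 1# , at (≈-sym (*-identityˡ (D j)))
  multiple (suc d) with multiple d
  ... | c , D[d+j]≈cDj = λ' (d ℕ.+ j) * c ,
        at (≈-trans (*-congˡ (λ' (d ℕ.+ j)) (coeffwise D[d+j]≈cDj)) (≈-sym (*-assoc (λ' (d ℕ.+ j)) c (D j))))

∣P-resp : ∀ {p p' r r'} → p ≈ p' → r ≈ r' → p ∣P r → p' ∣P r'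
∣P-resp {p} {p'} {r} {r'} p≈p' r≈r' (c , r≈cp) =
  c , at (≈-trans (≈-sym r≈r') (≈-trans (coeffwise r≈cp) (*-congˡ c p≈p')))

transpose : ∀ {m n} → Mat m n → Mat n m
transpose A i j = A j i

orthoMatrix : ∀ N → Mat N N
orthoMatrix N i k = P (toℕ i) (toℕ k)

orthoMatrix-det : ∀ N → det N (orthoMatrix N) ≈ 1#
orthoMatrix-det N =
  det-unitLower N (orthoMatrix N) (λ r c → P-above (toℕ r) (toℕ c)) (λ r → P-diagonal (toℕ r))

orthoMatrixᵀ-det : ∀ N → det N (transpose (orthoMatrix N)) ≈ 1#
orthoMatrixᵀ-det N =
  det-unitUpper N (transpose (orthoMatrix N)) (λ r c → P-above (toℕ c) (toℕ r)) (λ r → P-diagonal (toℕ r))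

product-entry : ∀ n (i j : Fin (suc n)) →
  ((orthoMatrix (suc n) ⊗ dfMatrix n) ⊗ transpose (orthoMatrix (suc n))) i j ≈ conjHankel (suc n) i j
product-entry n i j = begin
  sumF (suc n) (λ l → entryPH l * p j l)    ≡⟨ sumF≡sum (suc n) (λ l → entryPH l * p j l) ⟩
  ∑[ l < suc n ] (entryPH l * p j l)        ≈⟨ sum-cong-≋ {suc n} (λ l → *-congʳ (p j l) (entryPH≈pairing l)) ⟩
  conjHankel (suc n) i j                    ∎
  where
  p : Fin (suc n) → Fin (suc n) → Poly
  p r k = P (toℕ r) (toℕ k)
  entryPH : Fin (suc n) → Poly
  entryPH l = sumF (suc n) (λ k → p i k * qDFact (toℕ k ℕ.+ toℕ l))
  entryPH≈pairing : ∀ l → entryPH l ≈ pairing (suc n) (toℕ i) (toℕ l)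
  entryPH≈pairing l = ≈-trans (≡-to-≈ (sumF≡sum (suc n) (λ k → p i k * qDFact (toℕ k ℕ.+ toℕ l))))
    (sum-cong-≋ {suc n} (λ k → *-congˡ (p i k) (≈-sym (moment-closed (toℕ k ℕ.+ toℕ l)))))

dfSNF-diagonal : ∀ n (i i' : Fin (suc n)) → toℕ i ≡ toℕ i' → dfSNF n i i' ≈ D (toℕ i)
dfSNF-diagonal n i i' i≡i' with toℕ i ℕ.≟ toℕ i'
... | yes _    = ≈-sym (D-closed (toℕ i))
... | no i≢i'  = ⊥-elim (i≢i' i≡i')

dfSNF-offDiagonal : ∀ n (i j : Fin (suc n)) → toℕ i ≢ toℕ j → dfSNF n i j ≈ 0#
dfSNF-offDiagonal n i j i≢j with toℕ i ℕ.≟ toℕ j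
... | yes i≡j = ⊥-elim (i≢j i≡j)
... | no _    = ≈-refl

conjugation : ∀ n → ((orthoMatrix (suc n) ⊗ dfMatrix n) ⊗ transpose (orthoMatrix (suc n))) ≈M dfSNF n
conjugation n i j = at (≈-trans (product-entry n i j) (entries-agree (toℕ i ℕ.≟ toℕ j)))
  where
  entries-agree : Dec (toℕ i ≡ toℕ j) → conjHankel (suc n) i j ≈ dfSNF n i j
  entries-agree (yes i≡j) =
    ≈-trans (≡.subst (λ j' → conjHankel (suc n) i j' ≈ D (toℕ i)) (toℕ-injective i≡j)
                     (conjHankel-diagonal (suc n) i))
            (≈-sym (dfSNF-diagonal n i j i≡j))
  entries-agree (no i≢j) =
    ≈-trans (conjHankel-offDiagonal (suc n) i j i≢j) (≈-sym (dfSNF-offDiagonal n i j i≢j))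

divisibility-chain : ∀ n → DiagDivChain (dfSNF n)
divisibility-chain n i j i' j' i≡i' j≡j' j≤i =
  ∣P-resp (≈-sym (dfSNF-diagonal n j j' j≡j')) (≈-sym (dfSNF-diagonal n i i' i≡i')) (D-divides j≤i)

corollary4p10 : (n : ℕ) → IsSSNF (dfMatrix n) (dfSNF n)
corollary4p10 n =
  orthoMatrix (suc n) , transpose (orthoMatrix (suc n)) ,
  at (orthoMatrix-det (suc n)) , at (orthoMatrixᵀ-det (suc n)) ,
  conjugation n , (λ i j i≢j → at (dfSNF-offDiagonal n i j i≢j)) , divisibility-chain n
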